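{- Let $T$ be a maximal outerplanar graph of order 6. For every boundary edge $e$ of $T$ there exists a total dominating set $D$ of $T$ with $|D|=2$ that contains exactly one of the endpoints of $e$.
   Context: A maximal outerplanar graph (MOP) is a biconnected planar graph with a plane embedding in which all vertices lie on the boundary cycle of the outer face and all bounded faces are triangles; boundary edges are the edges of that cycle. A total dominating set of a graph $G=(V,E)$ is a set $D\subseteq V$ such that every vertex of $V$ (including those in $D$) is adjacent to some vertex of $D$. -}

module Defs where

open import Data.Nat using (ℕ; suc; _<_)
open import Data.Fin using (Fin; toℕ)
open import Data.Fin.Subset using (Subset; _∈_; _∉_; ∣_∣)
open import Data.Bool using (Bool; true; false)
open import Data.Product using (Σ; _×_; ∃-syntax)
open import Data.Sum using (_⊎_)
open import Relation.Binary.PropositionalEquality using (_≡_; _≢_)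
open import Relation.Nullary using (¬_)
open import Function.Definitions using (Injective)

record Graph (n : ℕ) : Set where
  field
    adj   : Fin n → Fin n → Bool
    sym   : ∀ u v → adj u v ≡ adj v u
    irrefl : ∀ u → adj u u ≡ false

open Graph public

Adj : ∀ {n} → Graph n → Fin n → Fin n → Set
Adj G u v = adj G u v ≡ true

-- Cyclic-order geometry on a placement pos : vertices → positions 0..n-1
-- around the outer (boundary) cycle.
module Cyclic {n : ℕ} (pos : Fin n → Fin n) where

  p : Fin n → ℕ
  p v = toℕ (pos v)

  Between : Fin n → Fin n → Fin n → Set
  Between a b c = (p a < p c × p c < p b) ⊎ (p b < p c × p c < p a)

  Outside : Fin n → Fin n → Fin n → Set
  Outside a b c = ¬ Between a b c × p c ≢ p a × p c ≢ p b

  Cross : Fin n → Fin n → Fin n → Fin n → Set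
  Cross a b x y = (Between a b x × Outside a b y) ⊎ (Outside a b x × Between a b y)

  Consec : Fin n → Fin n → Set
  Consec u v = p v ≡ suc (p u) ⊎ (suc (p u) ≡ n × p v ≡ 0)

  BoundaryPair : Fin n → Fin n → Set
  BoundaryPair u v = Consec u v ⊎ Consec v u

-- A maximal outerplanar graph: a simple graph together with an outerplane
-- embedding, given combinatorially by the cyclic order of the vertices on the
-- boundary cycle of the outer face; all boundary-cycle edges are present, no
-- two edges cross (outerplane), and every bounded face is a triangle, i.e.
-- no further non-crossing chord can be added (edge-maximality).
record MOP (n : ℕ) : Set where
  field
    graph      : Graph n
    pos        : Fin n → Fin n
    pos-inj    : Injective _≡_ _≡_ pos
  open Cyclic pos
  field
    boundary   : ∀ u v → Consec u v → Adj graph u v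
    noncross   : ∀ u v x y → Adj graph u v → Adj graph x y → ¬ Cross u v x y
    maximal    : ∀ u v → u ≢ v → ¬ Adj graph u v →
                   ∃[ x ] ∃[ y ] (Adj graph x y × Cross u v x y)

open MOP public

BoundaryEdge : ∀ {n} → MOP n → Fin n → Fin n → Set
BoundaryEdge T u v = Cyclic.BoundaryPair (pos T) u v

TotalDominating : ∀ {n} → Graph n → Subset n → Set
TotalDominating G D = ∀ v → ∃[ u ] (u ∈ D × Adj G v u)

ExactlyOneOf : ∀ {n} → Subset n → Fin n → Fin n → Set
ExactlyOneOf D u v = (u ∈ D × v ∉ D) ⊎ (v ∈ D × u ∉ D)

{-# OPTIONS --safe #-}
module Submission where

-- Numbering the vertices of T by their place on the boundary cycle turns T into a
-- triangulation of the hexagon 0 1 2 3 4 5, and such a triangulation is determined by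
-- which of the nine diagonals it draws. Running through all 2⁹ sets of diagonals
-- shows that in each of the 14 triangulations every side {i, i+1} is split by some
-- pair {a, b} of distinct vertices such that every vertex is adjacent to a or to b;
-- such a pair is a total dominating set of size 2.

open import Defs
open import Data.Bool using (Bool; true; false)
import Data.Bool.Properties as Bool
open import Data.Empty using (⊥-elim)
open import Data.Fin using (Fin; zero; suc; #_; _≟_; punchOut)
import Data.Fin.Properties as Fin
open import Data.Fin.Subset using (Subset; ∣_∣; ⁅_⁆; _∪_; _∈_)
open import Data.Fin.Subset.Properties
  using (_∈?_; anySubset?; x∈⁅y⁆⇔x≡y; ∣⁅x⁆∣≡1; ∪-identityˡ; ∪-identityʳ; x∈p∪q⁺; x∈p∪q⁻)
open import Data.Nat using (ℕ; _<?_)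
import Data.Nat as ℕ
import Data.Nat.Properties as ℕ
open import Data.Product using (_×_; _,_; ∃-syntax; proj₁; proj₂; uncurry)
open import Data.Product.Properties using (≡-dec)
open import Data.Sum using (_⊎_; inj₁; inj₂; swap)
import Data.Sum as Sum
open import Data.Sum.Function.Propositional using (_⊎-cong_)
open import Data.Vec using (Vec; []; _∷_; lookup; tabulate)
open import Data.Vec.Properties using (lookup∘tabulate)
open import Function using (_∘_; id)
open import Function.Bundles using (_⇔_; mk⇔; Equivalence)
open import Function.Definitions using (Injective)
import Function.Properties.Equivalence as ⇔
open import Relation.Binary.PropositionalEquality using (_≡_; _≢_; refl; trans; cong; subst)
import Relation.Binary.PropositionalEquality as ≡
open import Relation.Nullary using (¬_; Dec; yes; no; contradiction)
open import Relation.Nullary.Decidable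
  using (¬?; _×-dec_; _⊎-dec_; _→-dec_; toWitness; toWitnessFalse; decidable-stable)

open Equivalence using (to; from)

injective⇒surjective : ∀ {n} {f : Fin n → Fin n} → Injective _≡_ _≡_ f → ∀ i → ∃[ v ] f v ≡ i
injective⇒surjective {ℕ.suc m} {f} f-inj i with Fin.any? (λ v → f v ≟ i)
... | yes hit = hit
... | no miss = contradiction (Fin.injective⇒≤ squeeze-injective) ℕ.1+n≰n
  where
  avoids : ∀ v → i ≢ f v
  avoids v i≡fv = miss (v , ≡.sym i≡fv)

  squeeze : Fin (ℕ.suc m) → Fin m
  squeeze v = punchOut (avoids v)

  squeeze-injective : Injective _≡_ _≡_ squeeze
  squeeze-injective {v} {w} = f-inj ∘ Fin.punchOut-injective (avoids v) (avoids w)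

∣⁅x⁆∪⁅y⁆∣≡2 : ∀ {n} {x y : Fin n} → x ≢ y → ∣ ⁅ x ⁆ ∪ ⁅ y ⁆ ∣ ≡ 2
∣⁅x⁆∪⁅y⁆∣≡2 {x = zero}  {zero}  x≢y = ⊥-elim (x≢y refl)
∣⁅x⁆∪⁅y⁆∣≡2 {x = zero}  {suc y} _   = cong ℕ.suc (trans (cong ∣_∣ (∪-identityˡ ⁅ y ⁆)) (∣⁅x⁆∣≡1 y))
∣⁅x⁆∪⁅y⁆∣≡2 {x = suc x} {zero}  _   = cong ℕ.suc (trans (cong ∣_∣ (∪-identityʳ ⁅ x ⁆)) (∣⁅x⁆∣≡1 x))
∣⁅x⁆∪⁅y⁆∣≡2 {x = suc x} {suc y} x≢y = ∣⁅x⁆∪⁅y⁆∣≡2 (x≢y ∘ cong suc)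

x∈⁅y⁆∪⁅z⁆⇔x≡y⊎x≡z : ∀ {n} {x y z : Fin n} → x ∈ ⁅ y ⁆ ∪ ⁅ z ⁆ ⇔ (x ≡ y ⊎ x ≡ z)
x∈⁅y⁆∪⁅z⁆⇔x≡y⊎x≡z {y = y} {z} = mk⇔
  (Sum.map (to x∈⁅y⁆⇔x≡y) (to x∈⁅y⁆⇔x≡y) ∘ x∈p∪q⁻ ⁅ y ⁆ ⁅ z ⁆)
  (x∈p∪q⁺ ∘ Sum.map (from x∈⁅y⁆⇔x≡y) (from x∈⁅y⁆⇔x≡y))

ExactlyOneOf-preimage : ∀ {m n} {D : Subset m} {E : Subset n} (f : Fin n → Fin m) →
                        (∀ x → x ∈ E ⇔ f x ∈ D) →
                        ∀ {u v} → ExactlyOneOf D (f u) (f v) → ExactlyOneOf E u v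
ExactlyOneOf-preimage f E⇔D {u} {v} (inj₁ (fu∈D , fv∉D)) = inj₁ (from (E⇔D u) fu∈D , fv∉D ∘ to (E⇔D v))
ExactlyOneOf-preimage f E⇔D {u} {v} (inj₂ (fv∈D , fu∉D)) = inj₂ (from (E⇔D v) fv∈D , fu∉D ∘ to (E⇔D u))

exactlyOneOf? : ∀ {n} (D : Subset n) (u v : Fin n) → Dec (ExactlyOneOf D u v)
exactlyOneOf? D u v = (u ∈? D ×-dec ¬? (v ∈? D)) ⊎-dec (v ∈? D ×-dec ¬? (u ∈? D))

Adjacency : ℕ → Set
Adjacency n = Fin n → Fin n → Bool

_≗₂_ : ∀ {n} → Adjacency n → Adjacency n → Set
A ≗₂ B = ∀ u v → A u v ≡ B u v

module _ {n : ℕ} where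

  TotallyDominatingPair : Adjacency n → Fin n → Fin n → Set
  TotallyDominatingPair A a b = a ≢ b × (∀ w → A w a ≡ true ⊎ A w b ≡ true)

  SplitByDominatingPair : Adjacency n → Fin n → Fin n → Set
  SplitByDominatingPair A u v =
    ∃[ a ] ∃[ b ] (TotallyDominatingPair A a b × ExactlyOneOf (⁅ a ⁆ ∪ ⁅ b ⁆) u v)

  pair-totalDominating : ∀ (G : Graph n) {a b} → TotallyDominatingPair (adj G) a b →
                         TotalDominating G (⁅ a ⁆ ∪ ⁅ b ⁆)
  pair-totalDominating G {a} {b} (_ , dominates) = neighbour ∘ dominates
    where
    neighbour : ∀ {w} → Adj G w a ⊎ Adj G w b → ∃[ u ] (u ∈ ⁅ a ⁆ ∪ ⁅ b ⁆ × Adj G w u)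
    neighbour (inj₁ wa) = a , from x∈⁅y⁆∪⁅z⁆⇔x≡y⊎x≡z (inj₁ refl) , wa
    neighbour (inj₂ wb) = b , from x∈⁅y⁆∪⁅z⁆⇔x≡y⊎x≡z (inj₂ refl) , wb

  SplitByDominatingPair-sym : ∀ {A u v} → SplitByDominatingPair A u v → SplitByDominatingPair A v u
  SplitByDominatingPair-sym (a , b , dominating , one) = a , b , dominating , swap one

  SplitByDominatingPair-resp : ∀ {A B} → A ≗₂ B → ∀ {u v} →
                               SplitByDominatingPair A u v → SplitByDominatingPair B u v
  SplitByDominatingPair-resp A≗B (a , b , (a≢b , dominates) , one) =
    a , b , (a≢b , Sum.map (trans (≡.sym (A≗B _ a))) (trans (≡.sym (A≗B _ b))) ∘ dominates) , one

  splitByDominatingPair? : ∀ A u v → Dec (SplitByDominatingPair A u v)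
  splitByDominatingPair? A u v = Fin.any? λ a → Fin.any? λ b →
    (¬? (a ≟ b) ×-dec Fin.all? (λ w → (A w a Bool.≟ true) ⊎-dec (A w b Bool.≟ true)))
    ×-dec exactlyOneOf? (⁅ a ⁆ ∪ ⁅ b ⁆) u v

module Polygon {n : ℕ} where

  open Cyclic {n} id public

  NonCrossing : Adjacency n → Set
  NonCrossing A = ∀ u v x y → A u v ≡ true → A x y ≡ true → ¬ Cross u v x y

  Maximal : Adjacency n → Set
  Maximal A = ∀ u v → u ≢ v → ¬ A u v ≡ true → ∃[ x ] ∃[ y ] (A x y ≡ true × Cross u v x y)

  record IsTriangulation (A : Adjacency n) : Set where
    field
      symmetric   : ∀ u v → A u v ≡ A v u
      irreflexive : ∀ u → A u u ≡ false
      sides       : ∀ u v → Consec u v → A u v ≡ true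
      nonCrossing : NonCrossing A
      maximal     : Maximal A

  SidesSplit : Adjacency n → Set
  SidesSplit A = ∀ u v → Consec u v → SplitByDominatingPair A u v

  SidesSplit⇒BoundaryPairsSplit : ∀ {A} → SidesSplit A →
                                  ∀ u v → BoundaryPair u v → SplitByDominatingPair A u v
  SidesSplit⇒BoundaryPairsSplit split u v (inj₁ u→v) = split u v u→v
  SidesSplit⇒BoundaryPairsSplit split u v (inj₂ v→u) = SplitByDominatingPair-sym (split v u v→u)

  NonCrossing-resp : ∀ {A B} → A ≗₂ B → NonCrossing A → NonCrossing B
  NonCrossing-resp A≗B noncrossing u v x y uv xy =
    noncrossing u v x y (trans (A≗B u v) uv) (trans (A≗B x y) xy)

  Maximal-resp : ∀ {A B} → A ≗₂ B → Maximal A → Maximal B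
  Maximal-resp A≗B saturated u v u≢v ¬uv with saturated u v u≢v (¬uv ∘ trans (≡.sym (A≗B u v)))
  ... | x , y , xy , crossing = x , y , trans (≡.sym (A≗B x y)) xy , crossing

  between? : ∀ a b c → Dec (Between a b c)
  between? a b c = ((p a <? p c) ×-dec (p c <? p b)) ⊎-dec ((p b <? p c) ×-dec (p c <? p a))

  outside? : ∀ a b c → Dec (Outside a b c)
  outside? a b c = ¬? (between? a b c) ×-dec ¬? (p c ℕ.≟ p a) ×-dec ¬? (p c ℕ.≟ p b)

  cross? : ∀ a b x y → Dec (Cross a b x y)
  cross? a b x y = (between? a b x ×-dec outside? a b y) ⊎-dec (outside? a b x ×-dec between? a b y)

  consec? : ∀ u v → Dec (Consec u v)
  consec? u v = (p v ℕ.≟ ℕ.suc (p u)) ⊎-dec ((ℕ.suc (p u) ℕ.≟ n) ×-dec (p v ℕ.≟ 0))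

  nonCrossing? : ∀ A → Dec (NonCrossing A)
  nonCrossing? A = Fin.all? λ u → Fin.all? λ v → Fin.all? λ x → Fin.all? λ y →
    (A u v Bool.≟ true) →-dec (A x y Bool.≟ true) →-dec ¬? (cross? u v x y)

  maximal? : ∀ A → Dec (Maximal A)
  maximal? A = Fin.all? λ u → Fin.all? λ v → ¬? (u ≟ v) →-dec ¬? (A u v Bool.≟ true) →-dec
    Fin.any? λ x → Fin.any? λ y → (A x y Bool.≟ true) ×-dec cross? u v x y

  sidesSplit? : ∀ A → Dec (SidesSplit A)
  sidesSplit? A = Fin.all? λ u → Fin.all? λ v → consec? u v →-dec splitByDominatingPair? A u v

open Polygon

data Segment : Set where
  point side : Segment
  diagonal   : Fin 9 → Segment

segment : Fin 6 → Fin 6 → Segment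
segment i j = lookup (lookup table i) j
  where
  table : Vec (Vec Segment 6) 6
  table = (point          ∷ side           ∷ diagonal (# 0) ∷ diagonal (# 1) ∷ diagonal (# 2) ∷ side           ∷ [])
        ∷ (side           ∷ point          ∷ side           ∷ diagonal (# 3) ∷ diagonal (# 4) ∷ diagonal (# 5) ∷ [])
        ∷ (diagonal (# 0) ∷ side           ∷ point          ∷ side           ∷ diagonal (# 6) ∷ diagonal (# 7) ∷ [])
        ∷ (diagonal (# 1) ∷ diagonal (# 3) ∷ side           ∷ point          ∷ side           ∷ diagonal (# 8) ∷ [])
        ∷ (diagonal (# 2) ∷ diagonal (# 4) ∷ diagonal (# 6) ∷ side           ∷ point          ∷ side           ∷ [])
        ∷ (side           ∷ diagonal (# 5) ∷ diagonal (# 7) ∷ diagonal (# 8) ∷ side           ∷ point          ∷ [])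
        ∷ []

endpoints : Fin 9 → Fin 6 × Fin 6
endpoints = lookup ((# 0 , # 2) ∷ (# 0 , # 3) ∷ (# 0 , # 4) ∷ (# 1 , # 3) ∷ (# 1 , # 4) ∷ (# 1 , # 5)
                   ∷ (# 2 , # 4) ∷ (# 2 , # 5) ∷ (# 3 , # 5) ∷ [])

SegmentBetween : Fin 6 → Fin 6 → Segment → Set
SegmentBetween i j point        = i ≡ j
SegmentBetween i j side         = BoundaryPair i j
SegmentBetween i j (diagonal d) = endpoints d ≡ (i , j) ⊎ endpoints d ≡ (j , i)

segmentBetween? : ∀ i j s → Dec (SegmentBetween i j s)
segmentBetween? i j point        = i ≟ j
segmentBetween? i j side         = consec? i j ⊎-dec consec? j i
segmentBetween? i j (diagonal d) = ≡-dec _≟_ _≟_ (endpoints d) (i , j) ⊎-dec ≡-dec _≟_ _≟_ (endpoints d) (j , i)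

segment-between : ∀ i j → SegmentBetween i j (segment i j)
segment-between = toWitness {a? = Fin.all? λ i → Fin.all? λ j → segmentBetween? i j (segment i j)} _

drawn : Subset 9 → Segment → Bool
drawn ds point        = false
drawn ds side         = true
drawn ds (diagonal d) = lookup ds d

hexagon : Subset 9 → Adjacency 6
hexagon ds i j = drawn ds (segment i j)

diagonalsOf : Adjacency 6 → Subset 9
diagonalsOf A = tabulate (uncurry A ∘ endpoints)

hexagon-diagonalsOf : ∀ {A} → IsTriangulation A → A ≗₂ hexagon (diagonalsOf A)
hexagon-diagonalsOf {A} tri i j = drawnAs (segment i j) (segment-between i j)
  where
  open IsTriangulation tri

  diagonal-drawn : ∀ d → lookup (diagonalsOf A) d ≡ uncurry A (endpoints d)
  diagonal-drawn = lookup∘tabulate (uncurry A ∘ endpoints)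

  drawnAs : ∀ s → SegmentBetween i j s → A i j ≡ drawn (diagonalsOf A) s
  drawnAs point        refl        = irreflexive i
  drawnAs side         (inj₁ i→j)  = sides i j i→j
  drawnAs side         (inj₂ j→i)  = trans (symmetric i j) (sides j i j→i)
  drawnAs (diagonal d) (inj₁ d≡ij) = ≡.sym (trans (diagonal-drawn d) (cong (uncurry A) d≡ij))
  drawnAs (diagonal d) (inj₂ d≡ji) =
    trans (symmetric i j) (≡.sym (trans (diagonal-drawn d) (cong (uncurry A) d≡ji)))

TriangulatedSidesSplit : Subset 9 → Set
TriangulatedSidesSplit ds = NonCrossing (hexagon ds) → Maximal (hexagon ds) → SidesSplit (hexagon ds)

hexagon-triangulatedSidesSplit : ∀ ds → TriangulatedSidesSplit ds
hexagon-triangulatedSidesSplit ds = decidable-stable (claim? ds) (λ ¬claim → noCounterexample (ds , ¬claim))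
  where
  claim? : ∀ ds → Dec (TriangulatedSidesSplit ds)
  claim? ds = nonCrossing? (hexagon ds) →-dec maximal? (hexagon ds) →-dec sidesSplit? (hexagon ds)

  noCounterexample : ¬ (∃[ ds ] ¬ TriangulatedSidesSplit ds)
  noCounterexample = toWitnessFalse {a? = anySubset? (¬? ∘ claim?)} _

triangulatedHexagon-sidesSplit : ∀ {A} → IsTriangulation {6} A → SidesSplit A
triangulatedHexagon-sidesSplit {A} tri u v u→v = SplitByDominatingPair-resp H≗A (hexagon-split u v u→v)
  where
  A≗H : A ≗₂ hexagon (diagonalsOf A)
  A≗H = hexagon-diagonalsOf tri

  H≗A : hexagon (diagonalsOf A) ≗₂ A
  H≗A u v = ≡.sym (A≗H u v)

  hexagon-split : SidesSplit (hexagon (diagonalsOf A))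
  hexagon-split = hexagon-triangulatedSidesSplit (diagonalsOf A)
    (NonCrossing-resp A≗H (IsTriangulation.nonCrossing tri)) (Maximal-resp A≗H (IsTriangulation.maximal tri))

module Positions {n : ℕ} (T : MOP n) where

  private
    G = graph T
    position = pos T

  vertexAt : Fin n → Fin n
  vertexAt i = proj₁ (injective⇒surjective (pos-inj T) i)

  position-vertexAt : ∀ i → position (vertexAt i) ≡ i
  position-vertexAt i = proj₂ (injective⇒surjective (pos-inj T) i)

  vertexAt-position : ∀ v → vertexAt (position v) ≡ v
  vertexAt-position v = pos-inj T (position-vertexAt (position v))

  vertexAt-injective : Injective _≡_ _≡_ vertexAt
  vertexAt-injective {i} {j} eq =
    trans (≡.sym (position-vertexAt i)) (trans (cong position eq) (position-vertexAt j))

  x≡vertexAt⇔position≡ : ∀ {v i} → v ≡ vertexAt i ⇔ position v ≡ i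
  x≡vertexAt⇔position≡ {v} {i} = mk⇔
    (λ v≡ → trans (cong position v≡) (position-vertexAt i))
    (λ ≡i → trans (≡.sym (vertexAt-position v)) (cong vertexAt ≡i))

  adjacency : Adjacency n
  adjacency i j = adj G (vertexAt i) (vertexAt j)

  triangulation : IsTriangulation adjacency
  triangulation = record
    { symmetric   = λ i j → Graph.sym G (vertexAt i) (vertexAt j)
    ; irreflexive = irrefl G ∘ vertexAt
    ; sides       = λ i j → boundary T (vertexAt i) (vertexAt j) ∘ consec-atVertices
    ; nonCrossing = λ i j k l ij kl → noncross T _ _ _ _ ij kl ∘ cross-atVertices
    ; maximal     = saturated
    }
    where
    consec-atVertices : ∀ {i j} → Consec i j → Consec (position (vertexAt i)) (position (vertexAt j))
    consec-atVertices {i} {j} rewrite position-vertexAt i | position-vertexAt j = id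

    cross-atVertices : ∀ {i j k l} → Cross i j k l →
                       Cross (position (vertexAt i)) (position (vertexAt j))
                             (position (vertexAt k)) (position (vertexAt l))
    cross-atVertices {i} {j} {k} {l}
      rewrite position-vertexAt i | position-vertexAt j | position-vertexAt k | position-vertexAt l = id

    cross-fromVertices : ∀ {i j x y} → Cross (position (vertexAt i)) (position (vertexAt j)) x y → Cross i j x y
    cross-fromVertices {i} {j} rewrite position-vertexAt i | position-vertexAt j = id

    adjacency-position : ∀ {x y} → Adj G x y → adjacency (position x) (position y) ≡ true
    adjacency-position {x} {y} rewrite vertexAt-position x | vertexAt-position y = id

    saturated : Maximal adjacency
    saturated i j i≢j ¬ij with maximal T (vertexAt i) (vertexAt j) (i≢j ∘ vertexAt-injective) ¬ij
    ... | x , y , xy , crossing = position x , position y , adjacency-position xy , cross-fromVertices crossing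

  fromPositions : ∀ {u v} → SplitByDominatingPair adjacency (position u) (position v) →
                  ∃[ D ] (TotalDominating G D × ∣ D ∣ ≡ 2 × ExactlyOneOf D u v)
  fromPositions (a , b , (a≢b , dominates) , one) =
    ⁅ vertexAt a ⁆ ∪ ⁅ vertexAt b ⁆ ,
    pair-totalDominating G dominating , ∣⁅x⁆∪⁅y⁆∣≡2 (proj₁ dominating) , ExactlyOneOf-preimage position member one
    where
    Dominated : Fin n → Set
    Dominated w = Adj G w (vertexAt a) ⊎ Adj G w (vertexAt b)

    dominating : TotallyDominatingPair (adj G) (vertexAt a) (vertexAt b)
    dominating = a≢b ∘ vertexAt-injective , λ w → subst Dominated (vertexAt-position w) (dominates (position w))

    member : ∀ v → v ∈ ⁅ vertexAt a ⁆ ∪ ⁅ vertexAt b ⁆ ⇔ position v ∈ ⁅ a ⁆ ∪ ⁅ b ⁆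
    member v = ⇔.trans x∈⁅y⁆∪⁅z⁆⇔x≡y⊎x≡z
      (⇔.trans (x≡vertexAt⇔position≡ ⊎-cong x≡vertexAt⇔position≡) (⇔.sym x∈⁅y⁆∪⁅z⁆⇔x≡y⊎x≡z))

lemma6 : (T : MOP 6) → (u v : Fin 6) → BoundaryEdge T u v →
         ∃[ D ] (TotalDominating (graph T) D × ∣ D ∣ ≡ 2 × ExactlyOneOf D u v)
lemma6 T u v boundaryEdge = fromPositions (splitsBoundary (pos T u) (pos T v) boundaryEdge)
  where
  open Positions T

  splitsBoundary : ∀ i j → BoundaryPair i j → SplitByDominatingPair adjacency i j
  splitsBoundary = SidesSplit⇒BoundaryPairsSplit (triangulatedHexagon-sidesSplit triangulation)
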